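{- Let $\mathcal{M}=\mathcal{M}(G;U,\rho,\tau)$ and $\widetilde{\mathcal{M}}=\mathcal{M}(\widetilde G;\widetilde U,\widetilde\rho,\widetilde\tau)$ be two algebraic maps. Then $\mathcal{M}\cong\widetilde{\mathcal{M}}$ if and only if there exists a group isomorphism $\sigma:G\to\widetilde G$ such that, for some $\widetilde y\in\widetilde G$, \[U^\sigma=\widetilde y^{ -1}\widetilde U\widetilde y,\qquad \rho^\sigma=\widetilde\rho,\qquad \tau^\sigma=\widetilde\tau.\]
   Context: An algebraic map $\mathcal{M}(G;U,\rho,\tau)$ consists of a group $G=\langle\rho,\tau\rangle$ with $\tau^2=1$ and a subgroup $U\le G$ such that the permutation representation of $G$ on the set $[G:U]$ of right cosets of $U$ (given by $(Ux)^a=Uxa$) is faithful. Two such maps $\mathcal{M}(G;U,\rho,\tau)$ and $\mathcal{M}(\widetilde G;\widetilde U,\widetilde\rho,\widetilde\tau)$ are isomorphic if there is a bijection $\mu:[G:U]\to[\widetilde G:\widetilde U]$ such that $(Ux)^{\mu\widetilde\rho}=(Ux)^{\rho\mu}$ and $(Ux)^{\mu\widetilde\tau}=(Ux)^{\tau\mu}$ for all $x\in G$ (maps composed left to right). -}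

module Defs where

open import Level using (Level; _⊔_; suc)
open import Algebra.Bundles using (Group)
open import Algebra.Morphism.Structures using (module GroupMorphisms)
open import Data.List using (List; []; _∷_)
open import Data.Product using (Σ; ∃; _×_; _,_)
open import Relation.Unary using (Pred; _∈_; _≐_)
open import Relation.Binary.Bundles using (Setoid)
open import Function.Bundles using (Bijection)
import Algebra.Properties.Group as GP
import Relation.Binary.Reasoning.Setoid as SR

private variable c ℓ c' ℓ' p p' : Level

record IsSubgroup (G : Group c ℓ) (U : Pred (Group.Carrier G) p) : Set (c ⊔ ℓ ⊔ p) where
  open Group G
  field
    resp  : ∀ {x y} → x ≈ y → x ∈ U → y ∈ U
    ε∈    : ε ∈ U
    ∙∈    : ∀ {x y} → x ∈ U → y ∈ U → (x ∙ y) ∈ U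
    ⁻¹∈   : ∀ {x} → x ∈ U → (x ⁻¹) ∈ U

data Letter : Set where
  ρ⁺ ρ⁻ τ' : Letter

module _ (G : Group c ℓ) where
  open Group G

  evalWord : Carrier → Carrier → List Letter → Carrier
  evalWord ρ τ []         = ε
  evalWord ρ τ (ρ⁺ ∷ w) = ρ ∙ evalWord ρ τ w
  evalWord ρ τ (ρ⁻ ∷ w) = ρ ⁻¹ ∙ evalWord ρ τ w
  evalWord ρ τ (τ' ∷ w) = τ ∙ evalWord ρ τ w

  GeneratedBy : Carrier → Carrier → Set (c ⊔ ℓ)
  GeneratedBy ρ τ = ∀ g → ∃ λ w → evalWord ρ τ w ≈ g

  -- Equality of right cosets: Ux = Uy  iff  x y⁻¹ ∈ U
  SameCoset : (U : Pred Carrier p) → Carrier → Carrier → Set p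
  SameCoset U x y = (x ∙ y ⁻¹) ∈ U

  -- The set [G:U] of right cosets of U, as a setoid on representatives.
  CosetSetoid : (U : Pred Carrier p) → IsSubgroup G U → Setoid c p
  CosetSetoid U sub = record
    { Carrier = Carrier
    ; _≈_ = SameCoset U
    ; isEquivalence = record { refl = r ; sym = s ; trans = t } }
    where
    open IsSubgroup sub
    open GP G using (⁻¹-anti-homo-∙; ⁻¹-involutive)
    open SR setoid
    r : ∀ {x} → SameCoset U x x
    r {x} = resp (sym (inverseʳ x)) ε∈
    s : ∀ {x y} → SameCoset U x y → SameCoset U y x
    s {x} {y} h = resp eq (⁻¹∈ h)
      where
      eq : (x ∙ y ⁻¹) ⁻¹ ≈ y ∙ x ⁻¹
      eq = begin
        (x ∙ y ⁻¹) ⁻¹        ≈⟨ ⁻¹-anti-homo-∙ x (y ⁻¹) ⟩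
        (y ⁻¹) ⁻¹ ∙ x ⁻¹     ≈⟨ ∙-congʳ (⁻¹-involutive y) ⟩
        y ∙ x ⁻¹ ∎
    t : ∀ {x y z} → SameCoset U x y → SameCoset U y z → SameCoset U x z
    t {x} {y} {z} h k = resp eq (∙∈ h k)
      where
      eq : (x ∙ y ⁻¹) ∙ (y ∙ z ⁻¹) ≈ x ∙ z ⁻¹
      eq = begin
        (x ∙ y ⁻¹) ∙ (y ∙ z ⁻¹)   ≈⟨ assoc x (y ⁻¹) (y ∙ z ⁻¹) ⟩
        x ∙ (y ⁻¹ ∙ (y ∙ z ⁻¹))   ≈⟨ ∙-congˡ (sym (assoc (y ⁻¹) y (z ⁻¹))) ⟩
        x ∙ ((y ⁻¹ ∙ y) ∙ z ⁻¹)   ≈⟨ ∙-congˡ (∙-congʳ (inverseˡ y)) ⟩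
        x ∙ (ε ∙ z ⁻¹)            ≈⟨ ∙-congˡ (identityˡ (z ⁻¹)) ⟩
        x ∙ z ⁻¹ ∎

  -- Faithfulness of the action of G on [G:U] by (Ux)^a = Uxa:
  -- an element fixing every coset is the identity.
  Faithful : (U : Pred Carrier p) → Set (c ⊔ ℓ ⊔ p)
  Faithful U = ∀ g → (∀ x → SameCoset U (x ∙ g) x) → g ≈ ε

record AlgebraicMap (G : Group c ℓ) (p : Level) : Set (c ⊔ ℓ ⊔ suc p) where
  open Group G
  field
    U         : Pred Carrier p
    U-sub     : IsSubgroup G U
    ρ τ       : Carrier
    τ²≈1      : τ ∙ τ ≈ ε
    generated : GeneratedBy G ρ τ
    faithful  : Faithful G U

  Cosets : Setoid c p
  Cosets = CosetSetoid G U U-sub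

module _ {G : Group c ℓ} {G̃ : Group c' ℓ'} where
  private
    module G = Group G
    module G̃ = Group G̃

  MapIso : AlgebraicMap G p → AlgebraicMap G̃ p' → Set (c ⊔ c' ⊔ p ⊔ p')
  MapIso M M̃ = Σ (Bijection (AlgebraicMap.Cosets M) (AlgebraicMap.Cosets M̃)) λ μ →
      (∀ x → SameCoset G̃ (AlgebraicMap.U M̃) (Bijection.to μ (x G.∙ AlgebraicMap.ρ M))
                                            (Bijection.to μ x G̃.∙ AlgebraicMap.ρ M̃))
    × (∀ x → SameCoset G̃ (AlgebraicMap.U M̃) (Bijection.to μ (x G.∙ AlgebraicMap.τ M))
                                            (Bijection.to μ x G̃.∙ AlgebraicMap.τ M̃))

Image : (G : Group c ℓ) (G̃ : Group c' ℓ') → (Group.Carrier G → Group.Carrier G̃) →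
        Pred (Group.Carrier G) p → Pred (Group.Carrier G̃) (c ⊔ ℓ' ⊔ p)
Image G G̃ σ U v = ∃ λ u → u ∈ U × Group._≈_ G̃ (σ u) v

Conjugate : (G : Group c ℓ) → Group.Carrier G → Pred (Group.Carrier G) p → Pred (Group.Carrier G) (c ⊔ ℓ ⊔ p)
Conjugate G y U v = ∃ λ w → w ∈ U × v ≈ (y ⁻¹ ∙ w) ∙ y
  where open Group G

IsGroupIsomorphism : (G : Group c ℓ) (G̃ : Group c' ℓ') → (Group.Carrier G → Group.Carrier G̃) → Set (c ⊔ c' ⊔ ℓ ⊔ ℓ')
IsGroupIsomorphism G G̃ = GroupMorphisms.IsGroupIsomorphism (Group.rawGroup G) (Group.rawGroup G̃)

-- An isomorphism μ of maps intertwines the actions of ρ, τ with those of ρ̃, τ̃,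
-- hence, by induction on words, every g ∈ G with some element σ g of G̃:
-- μ (U x g) = μ (U x) σ g.  Faithfulness of M̃ makes σ g unique, so σ is a
-- homomorphism; faithfulness of M makes it injective, and G̃ = ⟨ρ̃, τ̃⟩ makes it
-- onto.  Putting x = 1 and μ U = Ũ ỹ shows U^σ = ỹ⁻¹ Ũ ỹ.  Conversely such σ
-- and ỹ give the isomorphism U x ↦ Ũ ỹ σ x.
module Submission where

open import Defs
open import Level using (Level; _⊔_)
open import Algebra.Bundles using (Group)
open import Algebra.Morphism.Structures using (module GroupMorphisms)
import Algebra.Properties.Group as GroupProperties
open import Data.List using ([]; _∷_)
open import Data.Product using (Σ; ∃; _×_; _,_; proj₁; proj₂)
open import Function.Bundles using (_⇔_; mk⇔; Bijection)
open import Function.Definitions using (Injective; Surjective)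
open import Relation.Binary.Bundles using (Setoid)
open import Relation.Unary using (Pred; _∈_; _≐_)
import Relation.Binary.Reasoning.Setoid as SetoidReasoning

private variable c ℓ c' ℓ' p p' : Level

module GroupLemmas (G : Group c ℓ) where
  open Group G
  open GroupProperties G
  open SetoidReasoning setoid

  ∙-quotientʳ : ∀ x y h → (x ∙ h) ∙ (y ∙ h) ⁻¹ ≈ x ∙ y ⁻¹
  ∙-quotientʳ x y h = begin
    (x ∙ h) ∙ (y ∙ h) ⁻¹      ≈⟨ ∙-congˡ (⁻¹-anti-homo-∙ y h) ⟩
    (x ∙ h) ∙ (h ⁻¹ ∙ y ⁻¹)   ≈⟨ assoc (x ∙ h) (h ⁻¹) (y ⁻¹) ⟨
    ((x ∙ h) ∙ h ⁻¹) ∙ y ⁻¹   ≈⟨ ∙-congʳ (//-rightDividesʳ h x) ⟩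
    x ∙ y ⁻¹                  ∎

  ∙-quotientˡ : ∀ y a b → (y ∙ a) ∙ (y ∙ b) ⁻¹ ≈ (y ∙ (a ∙ b ⁻¹)) ∙ y ⁻¹
  ∙-quotientˡ y a b = begin
    (y ∙ a) ∙ (y ∙ b) ⁻¹      ≈⟨ ∙-congˡ (⁻¹-anti-homo-∙ y b) ⟩
    (y ∙ a) ∙ (b ⁻¹ ∙ y ⁻¹)   ≈⟨ assoc (y ∙ a) (b ⁻¹) (y ⁻¹) ⟨
    ((y ∙ a) ∙ b ⁻¹) ∙ y ⁻¹   ≈⟨ ∙-congʳ (assoc y a (b ⁻¹)) ⟩
    (y ∙ (a ∙ b ⁻¹)) ∙ y ⁻¹   ∎

  ∈Conjugate⇒∈ : ∀ {U : Pred Carrier p} → (∀ {x y} → x ≈ y → x ∈ U → y ∈ U) →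
                 ∀ {y v} → v ∈ Conjugate G y U → (y ∙ v) ∙ y ⁻¹ ∈ U
  ∈Conjugate⇒∈ resp {y} {v} (w , w∈U , v≈) = resp (sym conjugated) w∈U
    where
    conjugated : (y ∙ v) ∙ y ⁻¹ ≈ w
    conjugated = begin
      (y ∙ v) ∙ y ⁻¹                  ≈⟨ ∙-congʳ (∙-congˡ v≈) ⟩
      (y ∙ ((y ⁻¹ ∙ w) ∙ y)) ∙ y ⁻¹   ≈⟨ ∙-congʳ (assoc y (y ⁻¹ ∙ w) y) ⟨
      ((y ∙ (y ⁻¹ ∙ w)) ∙ y) ∙ y ⁻¹   ≈⟨ ∙-congʳ (∙-congʳ (\\-leftDividesˡ y w)) ⟩
      (w ∙ y) ∙ y ⁻¹                  ≈⟨ //-rightDividesʳ y w ⟩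
      w                               ∎

  Conjugate-resp : ∀ {U : Pred Carrier p} {y v v′} → v ≈ v′ →
                   v ∈ Conjugate G y U → v′ ∈ Conjugate G y U
  Conjugate-resp v≈v′ (w , w∈U , v≈) = w , w∈U , trans (sym v≈v′) v≈

  ∈⇒∈Conjugate : ∀ {U : Pred Carrier p} {y v} → (y ∙ v) ∙ y ⁻¹ ∈ U → v ∈ Conjugate G y U
  ∈⇒∈Conjugate {y = y} {v} w∈U = (y ∙ v) ∙ y ⁻¹ , w∈U , sym (begin
    (y ⁻¹ ∙ ((y ∙ v) ∙ y ⁻¹)) ∙ y   ≈⟨ ∙-congʳ (assoc (y ⁻¹) (y ∙ v) (y ⁻¹)) ⟨
    ((y ⁻¹ ∙ (y ∙ v)) ∙ y ⁻¹) ∙ y   ≈⟨ ∙-congʳ (∙-congʳ (\\-leftDividesʳ y v)) ⟩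
    (v ∙ y ⁻¹) ∙ y                  ≈⟨ //-rightDividesˡ y v ⟩
    v                               ∎)

module Cosets (G : Group c ℓ) {U : Pred (Group.Carrier G) p} (U-sub : IsSubgroup G U) where
  open Group G
  open GroupProperties G using (x∙y⁻¹≈ε⇒x≈y; x≈y⇒x∙y⁻¹≈ε; ε⁻¹≈ε; //-rightDividesʳ)
  open GroupLemmas G using (∙-quotientʳ)
  open IsSubgroup U-sub
  open Setoid (CosetSetoid G U U-sub) public
    using () renaming (_≈_ to _∼_; refl to ∼-refl; sym to ∼-sym; trans to ∼-trans)

  ≈⇒∼ : ∀ {x y} → x ≈ y → x ∼ y
  ≈⇒∼ x≈y = resp (sym (x≈y⇒x∙y⁻¹≈ε x≈y)) ε∈

  ∼-∙ʳ : ∀ {x y} h → x ∼ y → (x ∙ h) ∼ (y ∙ h)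
  ∼-∙ʳ {x} {y} h = resp (sym (∙-quotientʳ x y h))

  ∈⇒∼ε : ∀ {u} → u ∈ U → u ∼ ε
  ∈⇒∼ε {u} = resp (sym (trans (∙-congˡ ε⁻¹≈ε) (identityʳ u)))

  ∼ε⇒∈ : ∀ {u} → u ∼ ε → u ∈ U
  ∼ε⇒∈ {u} = resp (trans (∙-congˡ ε⁻¹≈ε) (identityʳ u))

  faithful⇒∙-cancelˡ : Faithful G U → ∀ {a b} → (∀ x → (x ∙ a) ∼ (x ∙ b)) → a ≈ b
  faithful⇒∙-cancelˡ faithful {a} {b} xa∼xb = x∙y⁻¹≈ε⇒x≈y a b (faithful (a ∙ b ⁻¹) λ x →
    ∼-trans (≈⇒∼ (sym (assoc x a (b ⁻¹))))
      (∼-trans (∼-∙ʳ (b ⁻¹) (xa∼xb x)) (≈⇒∼ (//-rightDividesʳ b x))))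

module _ {G : Group c ℓ} {G̃ : Group c' ℓ'} {σ : Group.Carrier G → Group.Carrier G̃} where
  private
    module G = Group G
    module G̃ = Group G̃

  Image-≐ : ∀ {U : Pred G.Carrier p} {V : Pred G̃.Carrier p'} →
            Surjective G._≈_ G̃._≈_ σ → (∀ {x y} → x G̃.≈ y → x ∈ V → y ∈ V) →
            (∀ {u} → u ∈ U → σ u ∈ V) → (∀ {u} → σ u ∈ V → u ∈ U) →
            Image G G̃ σ U ≐ V
  Image-≐ {U = U} {V = V} surjective respV U⇒V V⇒U = image⊆V , V⊆image
    where
    image⊆V : ∀ {v} → v ∈ Image G G̃ σ U → v ∈ V
    image⊆V (u , u∈U , σu≈v) = respV σu≈v (U⇒V u∈U)

    V⊆image : ∀ {v} → v ∈ V → v ∈ Image G G̃ σ U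
    V⊆image {v} v∈V = u , V⇒U (respV (G̃.sym σu≈v) v∈V) , σu≈v
      where
      u = proj₁ (surjective v)
      σu≈v = proj₂ (surjective v) G.refl

  ∈Image⇒∈ : ∀ {U : Pred G.Carrier p} → Injective G._≈_ G̃._≈_ σ →
             (∀ {x y} → x G.≈ y → x ∈ U → y ∈ U) →
             ∀ {g} → σ g ∈ Image G G̃ σ U → g ∈ U
  ∈Image⇒∈ injective respU (u , u∈U , σu≈σg) = respU (injective σu≈σg) u∈U

module FromMapIso {G : Group c ℓ} {G̃ : Group c' ℓ'}
    (M : AlgebraicMap G p) (M̃ : AlgebraicMap G̃ p') (iso : MapIso M M̃) where
  private
    module G = Group G
    module G̃ = Group G̃
    module M = AlgebraicMap M
    module M̃ = AlgebraicMap M̃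
    module μ = Bijection (proj₁ iso)
    open GroupProperties G using (//-rightDividesˡ)
    open Cosets G M.U-sub using ()
      renaming (≈⇒∼ to ≈⇒∼₁; ∼-refl to ∼₁-refl; ∈⇒∼ε to ∈⇒∼₁ε; ∼ε⇒∈ to ∼₁ε⇒∈)
    open Cosets G̃ M̃.U-sub
    μ = μ.to
    ev = evalWord G M.ρ M.τ
    ẽv = evalWord G̃ M̃.ρ M̃.τ

  Intertwines : G.Carrier → G̃.Carrier → Set (c ⊔ p')
  Intertwines g g̃ = ∀ x → μ (x G.∙ g) ∼ (μ x G̃.∙ g̃)

  ρ-intertwines : Intertwines M.ρ M̃.ρ
  ρ-intertwines = proj₁ (proj₂ iso)

  τ-intertwines : Intertwines M.τ M̃.τ
  τ-intertwines = proj₂ (proj₂ iso)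

  intertwines-cong : ∀ {g h g̃ h̃} → g G.≈ h → g̃ G̃.≈ h̃ → Intertwines g g̃ → Intertwines h h̃
  intertwines-cong g≈h g̃≈h̃ g↦g̃ x =
    ∼-trans (μ.cong (≈⇒∼₁ (G.∙-congˡ (G.sym g≈h))))
      (∼-trans (g↦g̃ x) (≈⇒∼ (G̃.∙-congˡ g̃≈h̃)))

  intertwines-ε : Intertwines G.ε G̃.ε
  intertwines-ε x = ∼-trans (μ.cong (≈⇒∼₁ (G.identityʳ x))) (≈⇒∼ (G̃.sym (G̃.identityʳ (μ x))))

  intertwines-∙ : ∀ {g h g̃ h̃} → Intertwines g g̃ → Intertwines h h̃ →
                  Intertwines (g G.∙ h) (g̃ G̃.∙ h̃)
  intertwines-∙ {g} {h} {g̃} {h̃} g↦g̃ h↦h̃ x =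
    ∼-trans (μ.cong (≈⇒∼₁ (G.sym (G.assoc x g h))))
      (∼-trans (h↦h̃ (x G.∙ g))
        (∼-trans (∼-∙ʳ h̃ (g↦g̃ x)) (≈⇒∼ (G̃.assoc (μ x) g̃ h̃))))

  intertwines-⁻¹ : ∀ {g g̃} → Intertwines g g̃ → Intertwines (g G.⁻¹) (g̃ G̃.⁻¹)
  intertwines-⁻¹ {g} {g̃} g↦g̃ x =
    ∼-trans (≈⇒∼ (G̃.sym (GroupProperties.//-rightDividesʳ G̃ g̃ (μ x′))))
      (∼-∙ʳ (g̃ G̃.⁻¹) (∼-trans (∼-sym (g↦g̃ x′)) (μ.cong (≈⇒∼₁ (//-rightDividesˡ g x)))))
    where x′ = x G.∙ g G.⁻¹

  intertwines-evalWord : ∀ w → Intertwines (ev w) (ẽv w)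
  intertwines-evalWord []       = intertwines-ε
  intertwines-evalWord (ρ⁺ ∷ w) = intertwines-∙ ρ-intertwines (intertwines-evalWord w)
  intertwines-evalWord (ρ⁻ ∷ w) = intertwines-∙ (intertwines-⁻¹ ρ-intertwines) (intertwines-evalWord w)
  intertwines-evalWord (τ' ∷ w) = intertwines-∙ τ-intertwines (intertwines-evalWord w)

  intertwines-unique : ∀ {g g̃ h̃} → Intertwines g g̃ → Intertwines g h̃ → g̃ G̃.≈ h̃
  intertwines-unique {g} {g̃} {h̃} g↦g̃ g↦h̃ = faithful⇒∙-cancelˡ M̃.faithful λ x̃ →
    let x = proj₁ (μ.surjective x̃) ; μx∼x̃ = proj₂ (μ.surjective x̃) ∼₁-refl in
    ∼-trans (∼-∙ʳ g̃ (∼-sym μx∼x̃))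
      (∼-trans (∼-sym (g↦g̃ x)) (∼-trans (g↦h̃ x) (∼-∙ʳ h̃ μx∼x̃)))

  intertwines-injective : ∀ {g h g̃} → Intertwines g g̃ → Intertwines h g̃ → g G.≈ h
  intertwines-injective g↦g̃ h↦g̃ = Cosets.faithful⇒∙-cancelˡ G M.U-sub M.faithful λ x →
    μ.injective (∼-trans (g↦g̃ x) (∼-sym (h↦g̃ x)))

  -- σ g is read off any word for g; intertwines-unique makes the choice irrelevant.
  σ : G.Carrier → G̃.Carrier
  σ g = ẽv (proj₁ (M.generated g))

  σ-intertwines : ∀ g → Intertwines g (σ g)
  σ-intertwines g = intertwines-cong (proj₂ (M.generated g)) G̃.refl
                      (intertwines-evalWord (proj₁ (M.generated g)))

  σ-isGroupIsomorphism : IsGroupIsomorphism G G̃ σ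
  σ-isGroupIsomorphism = record
    { isGroupMonomorphism = record
      { isGroupHomomorphism = record
        { isMonoidHomomorphism = record
          { isMagmaHomomorphism = record
            { isRelHomomorphism = record { cong = σ-cong }
            ; homo = λ g h → intertwines-unique (σ-intertwines (g G.∙ h))
                               (intertwines-∙ (σ-intertwines g) (σ-intertwines h)) }
          ; ε-homo = intertwines-unique (σ-intertwines G.ε) intertwines-ε }
        ; ⁻¹-homo = λ g → intertwines-unique (σ-intertwines (g G.⁻¹))
                            (intertwines-⁻¹ (σ-intertwines g)) }
      ; injective = λ {g} {h} σg≈σh → intertwines-injective (σ-intertwines g)
                      (intertwines-cong G.refl (G̃.sym σg≈σh) (σ-intertwines h)) }
    ; surjective = σ-surjective }
    where
    σ-cong : ∀ {g h} → g G.≈ h → σ g G̃.≈ σ h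
    σ-cong {g} {h} g≈h = intertwines-unique (intertwines-cong g≈h G̃.refl (σ-intertwines g))
                                             (σ-intertwines h)

    σ-surjective : Surjective G._≈_ G̃._≈_ σ
    σ-surjective ỹ = ev w , λ {z} z≈ev → intertwines-unique (σ-intertwines z)
        (intertwines-cong (G.sym z≈ev) ẽvw≈ỹ (intertwines-evalWord w))
      where
      w = proj₁ (M̃.generated ỹ)
      ẽvw≈ỹ = proj₂ (M̃.generated ỹ)

  intertwines⇒σ≈ : ∀ {g g̃} → Intertwines g g̃ → σ g G̃.≈ g̃
  intertwines⇒σ≈ = intertwines-unique (σ-intertwines _)

  με∙σ∼μ : ∀ u → (μ G.ε G̃.∙ σ u) ∼ μ u
  με∙σ∼μ u = ∼-trans (∼-sym (σ-intertwines u G.ε)) (μ.cong (≈⇒∼₁ (G.identityˡ u)))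

  ∈⇒σ∈Conjugate : ∀ {u} → u ∈ M.U → σ u ∈ Conjugate G̃ (μ G.ε) M̃.U
  ∈⇒σ∈Conjugate {u} u∈U =
    GroupLemmas.∈⇒∈Conjugate G̃ (∼-trans (με∙σ∼μ u) (μ.cong (∈⇒∼₁ε u∈U)))

  σ∈Conjugate⇒∈ : ∀ {u} → σ u ∈ Conjugate G̃ (μ G.ε) M̃.U → u ∈ M.U
  σ∈Conjugate⇒∈ {u} σu∈ = ∼₁ε⇒∈ (μ.injective
    (∼-trans (∼-sym (με∙σ∼μ u)) (GroupLemmas.∈Conjugate⇒∈ G̃ (IsSubgroup.resp M̃.U-sub) σu∈)))

  Image≐Conjugate : Image G G̃ σ M.U ≐ Conjugate G̃ (μ G.ε) M̃.U
  Image≐Conjugate = Image-≐ {G = G} {G̃ = G̃}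
    (GroupMorphisms.IsGroupIsomorphism.surjective σ-isGroupIsomorphism)
    (GroupLemmas.Conjugate-resp G̃) ∈⇒σ∈Conjugate σ∈Conjugate⇒∈

module ToMapIso {G : Group c ℓ} {G̃ : Group c' ℓ'}
    (M : AlgebraicMap G p) (M̃ : AlgebraicMap G̃ p')
    {σ : Group.Carrier G → Group.Carrier G̃} (σ-iso : IsGroupIsomorphism G G̃ σ)
    (ỹ : Group.Carrier G̃)
    (Image≐Conjugate : Image G G̃ σ (AlgebraicMap.U M) ≐ Conjugate G̃ ỹ (AlgebraicMap.U M̃)) where
  private
    module G = Group G
    module G̃ = Group G̃
    module M = AlgebraicMap M
    module M̃ = AlgebraicMap M̃
    module σ = GroupMorphisms.IsGroupIsomorphism σ-iso
    open GroupLemmas G̃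
    open GroupProperties G̃ using (\\-leftDividesˡ)
    open Cosets G̃ M̃.U-sub

  μ : G.Carrier → G̃.Carrier
  μ x = ỹ G̃.∙ σ x

  μ-quotient : ∀ x y → μ x G̃.∙ μ y G̃.⁻¹ G̃.≈ (ỹ G̃.∙ σ (x G.∙ y G.⁻¹)) G̃.∙ ỹ G̃.⁻¹
  μ-quotient x y =
    G̃.trans (∙-quotientˡ ỹ (σ x) (σ y)) (G̃.∙-congʳ (G̃.∙-congˡ (G̃.sym σ-quotient)))
    where
    σ-quotient : σ (x G.∙ y G.⁻¹) G̃.≈ σ x G̃.∙ σ y G̃.⁻¹
    σ-quotient = G̃.trans (σ.∙-homo x (y G.⁻¹)) (G̃.∙-congˡ (σ.⁻¹-homo y))

  μ-cong : ∀ {x y} → SameCoset G M.U x y → μ x ∼ μ y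
  μ-cong {x} {y} xy⁻¹∈U = IsSubgroup.resp M̃.U-sub (G̃.sym (μ-quotient x y))
    (∈Conjugate⇒∈ (IsSubgroup.resp M̃.U-sub) (proj₁ Image≐Conjugate (_ , xy⁻¹∈U , G̃.refl)))

  μ-injective : ∀ {x y} → μ x ∼ μ y → SameCoset G M.U x y
  μ-injective {x} {y} μx∼μy = ∈Image⇒∈ {G = G} {G̃ = G̃} σ.injective (IsSubgroup.resp M.U-sub)
    (proj₂ Image≐Conjugate (∈⇒∈Conjugate (IsSubgroup.resp M̃.U-sub (μ-quotient x y) μx∼μy)))

  μ-surjective : ∀ z̃ → ∃ λ x → ∀ {z} → SameCoset G M.U z x → μ z ∼ z̃
  μ-surjective z̃ = x , λ z∼x → ∼-trans (μ-cong z∼x) (≈⇒∼ μx≈z̃)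
    where
    x = proj₁ (σ.surjective (ỹ G̃.⁻¹ G̃.∙ z̃))
    σx≈ỹ⁻¹z̃ = proj₂ (σ.surjective (ỹ G̃.⁻¹ G̃.∙ z̃)) G.refl
    μx≈z̃ = G̃.trans (G̃.∙-congˡ σx≈ỹ⁻¹z̃) (\\-leftDividesˡ ỹ z̃)

  μ-bijection : Bijection M.Cosets M̃.Cosets
  μ-bijection = record { to = μ ; cong = μ-cong ; bijective = μ-injective , μ-surjective }

  μ-equivariant : ∀ {a ã} → σ a G̃.≈ ã → ∀ x → μ (x G.∙ a) ∼ (μ x G̃.∙ ã)
  μ-equivariant {a} {ã} σa≈ã x = ≈⇒∼ (G̃.trans (G̃.∙-congˡ σxa≈σxã) (G̃.sym (G̃.assoc ỹ (σ x) ã)))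
    where
    σxa≈σxã : σ (x G.∙ a) G̃.≈ σ x G̃.∙ ã
    σxa≈σxã = G̃.trans (σ.∙-homo x a) (G̃.∙-congˡ σa≈ã)

theorem5p2 : ∀ {c ℓ c' ℓ' p p' : Level} {G : Group c ℓ} {G̃ : Group c' ℓ'}
    (M : AlgebraicMap G p) (M̃ : AlgebraicMap G̃ p') →
    MapIso M M̃ ⇔
    (Σ (Group.Carrier G → Group.Carrier G̃) λ σ →
       IsGroupIsomorphism G G̃ σ ×
       Σ (Group.Carrier G̃) (λ ỹ →
         Image G G̃ σ (AlgebraicMap.U M) ≐ Conjugate G̃ ỹ (AlgebraicMap.U M̃)) ×
       Group._≈_ G̃ (σ (AlgebraicMap.ρ M)) (AlgebraicMap.ρ M̃) ×
       Group._≈_ G̃ (σ (AlgebraicMap.τ M)) (AlgebraicMap.τ M̃))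
theorem5p2 {G = G} M M̃ = mk⇔
  (λ iso → let open FromMapIso M M̃ iso in
    σ , σ-isGroupIsomorphism , (Bijection.to (proj₁ iso) (Group.ε G) , Image≐Conjugate) ,
    intertwines⇒σ≈ ρ-intertwines , intertwines⇒σ≈ τ-intertwines)
  (λ (σ , σ-iso , (ỹ , Image≐Conjugate) , σρ≈ρ̃ , στ≈τ̃) →
    let open ToMapIso M M̃ σ-iso ỹ Image≐Conjugate in
    μ-bijection , μ-equivariant σρ≈ρ̃ , μ-equivariant στ≈τ̃)
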